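{- Let $n\ge 1$ and $A\subseteq\{1,\dots,n\}$ nonempty. If $\mathbf p$ is a reduced position of $SN(n,A)$, then $\mathrm{ctt}(\mathbf p,m)$ is reduced for every nonnegative integer $m$.
   Context: The game $SN(n,A)$ is played on $n$ stacks of tokens; a position is $\mathbf p=(p_1,\dots,p_n)$ of nonnegative integers. A move consists of choosing some $\ell\in A$ and $\ell$ distinct stacks, each of height at least $1$, and removing exactly one token from each. A terminal position is one with no legal move. For a position $\mathbf p$, let $\mathcal T(\mathbf p)$ be the set of terminal positions reachable from $\mathbf p$ by finite sequences of legal moves, $u_i(\mathbf p)=\min\{t_i:\mathbf t\in\mathcal T(\mathbf p)\}$, $r(\mathbf p)=\mathbf p-u(\mathbf p)$; $\mathbf p$ is reduced if $r(\mathbf p)=\mathbf p$. The "chop the top" function is defined by $\mathrm{ctt}(\mathbf p,m)_i=\min\{p_i,m\}$ for $i=1,\dots,n$. -}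

module Defs where

open import Data.Nat using (ℕ; zero; suc; _∸_; _≤_; _⊓_)
open import Data.Fin using (Fin)
open import Data.Fin.Subset using (Subset; _∈_; _∉_; ∣_∣)
open import Data.Product using (Σ; ∃; _×_)
open import Relation.Binary.PropositionalEquality using (_≡_)
open import Relation.Binary.Construct.Closure.ReflexiveTransitive using (Star)
open import Relation.Nullary using (¬_)

-- A position of SN(n,A): heights of the n stacks.
Position : ℕ → Set
Position n = Fin n → ℕ

Move : ∀ {n} → (ℕ → Set) → Position n → Position n → Set
Move {n} A p q =
  Σ ℕ λ ℓ → A ℓ × Σ (Subset n) λ S →
    (∣ S ∣ ≡ ℓ)
    × (∀ i → i ∈ S → 1 ≤ p i)
    × (∀ i → i ∈ S → q i ≡ p i ∸ 1)
    × (∀ i → i ∉ S → q i ≡ p i)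

Reachable : ∀ {n} → (ℕ → Set) → Position n → Position n → Set
Reachable A = Star (Move A)

Terminal : ∀ {n} → (ℕ → Set) → Position n → Set
Terminal A t = ∀ q → ¬ Move A t q

InT : ∀ {n} → (ℕ → Set) → Position n → Position n → Set
InT A p t = Reachable A p t × Terminal A t

-- k = u_i(p) = min { t_i : t ∈ 𝒯(p) }  (relational characterisation of the minimum)
IsU : ∀ {n} → (ℕ → Set) → Position n → Fin n → ℕ → Set
IsU A p i k =
  (∃ λ t → InT A p t × t i ≡ k) × (∀ t → InT A p t → k ≤ t i)

-- p is reduced iff r(p) = p - u(p) = p, componentwise.
Reduced : ∀ {n} → (ℕ → Set) → Position n → Set
Reduced A p = ∀ i k → IsU A p i k → p i ∸ k ≡ p i

ctt : ∀ {n} → Position n → ℕ → Position n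
ctt p m i = p i ⊓ m

-- Call stack i of x emptiable if some play from x empties it.  If it is,
-- then a * c ≤ Σⱼ min (x j, c) for some a ∈ A and every 1 ≤ c ≤ x i, by
-- induction along the play: a move of size ℓ through i followed by c rounds of
-- size a dominates c + 1 rounds of size min (a, ℓ).  Conversely, for c = x i
-- this inequality lets one play c moves of size a through i, each taking its
-- other tokens from the highest stacks first.  The inequality only sees
-- ctt x c, and ctt (ctt p m) c = ctt p c for c ≤ m, so the emptiable stacks of
-- p stay emptiable in ctt p m.  A position is reduced iff all its nonempty
-- stacks are emptiable; this step is classical (least elements, terminal
-- positions), but the statement is decidable, so the double-negation monad
-- suffices.
module Submission where

open import Defs
open import Data.Nat
  using (ℕ; zero; suc; _+_; _*_; _∸_; _⊓_; _≤_; _<_; _≤?_; _≤ᵇ_; _≟_; z≤n; s≤s)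
open import Data.Nat.Properties
open import Algebra.Properties.Semiring.Sum +-*-semiring
  using (sum; sum-cong-≗; ∑-distrib-+; *-distribʳ-sum)
open import Data.Nat.Induction using (<-wellFounded)
open import Data.Bool using (if_then_else_)
open import Data.Bool.Properties using (T-≡)
open import Data.Fin using (Fin; zero; suc)
open import Data.Fin.Subset using (Subset; inside; outside; _∈_; _∉_; _⊆_; ∣_∣; ⁅_⁆)
open import Data.Fin.Subset.Properties
  using (_∈?_; out⊆; in⊆in; drop-∷-⊆; p⊆q⇒∣p∣≤∣q∣; ∣⁅x⁆∣≡1; x∈⁅x⁆; x∈⁅y⁆⇒x≡y)
open import Data.Product using (∃; ∃-syntax; _×_; _,_; proj₁)
open import Data.Sum using (_⊎_; inj₁; inj₂; [_,_]′)
open import Data.Vec using ([]; _∷_; here; tabulate)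
open import Data.Vec.Properties using (lookup∘tabulate; lookup⇒[]=; []=⇒lookup)
open import Effect.Monad using (RawMonad)
open import Function using (_∘_; Equivalence)
open import Induction.WellFounded using (Acc; acc)
open import Level using (0ℓ)
open import Relation.Binary.Construct.Closure.ReflexiveTransitive using (ε; _◅_; _◅◅_)
open import Relation.Binary.PropositionalEquality
open import Relation.Nullary using (yes; no; does; contradiction)
open import Relation.Nullary.Decidable
  using (dec-true; dec-false; decidable-stable; ¬¬-excluded-middle)
open import Relation.Nullary.Negation using (DoubleNegation; ¬¬-Monad; ¬¬-map)

open RawMonad (¬¬-Monad {a = 0ℓ})

private
  variable
    n a c k m : ℕ
    j : Fin n
    S U X Y Z : Subset n

sum-mono-≤ : {f g : Fin n → ℕ} → (∀ j → f j ≤ g j) → sum f ≤ sum g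
sum-mono-≤ {zero}  f≤g = z≤n
sum-mono-≤ {suc n} f≤g = +-mono-≤ (f≤g zero) (sum-mono-≤ (f≤g ∘ suc))

𝟙 : Subset n → Fin n → ℕ
𝟙 S j = if does (j ∈? S) then 1 else 0

𝟙-∈ : j ∈ S → 𝟙 S j ≡ 1
𝟙-∈ {j = j} {S} j∈S = cong (if_then 1 else 0) (dec-true (j ∈? S) j∈S)

𝟙-∉ : j ∉ S → 𝟙 S j ≡ 0
𝟙-∉ {j = j} {S} j∉S = cong (if_then 1 else 0) (dec-false (j ∈? S) j∉S)

𝟙≤1 : ∀ (S : Subset n) j → 𝟙 S j ≤ 1
𝟙≤1 S j with j ∈? S
... | yes _ = ≤-refl
... | no  _ = z≤n

sum-𝟙 : ∀ (S : Subset n) → sum (𝟙 S) ≡ ∣ S ∣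
sum-𝟙 []            = refl
sum-𝟙 (inside  ∷ S) = cong suc (sum-𝟙 S)
sum-𝟙 (outside ∷ S) = sum-𝟙 S

sum-𝟙-* : ∀ (S : Subset n) k → sum (λ j → 𝟙 S j * k) ≡ ∣ S ∣ * k
sum-𝟙-* S k = trans (sym (*-distribʳ-sum k (𝟙 S))) (cong (_* k) (sum-𝟙 S))

∃-⊆-between : X ⊆ Z → ∣ X ∣ ≤ a → a ≤ ∣ Z ∣ → ∃[ S ] X ⊆ S × S ⊆ Z × ∣ S ∣ ≡ a
∃-⊆-between {X = []} {[]} _ _ z≤n = [] , (λ ()) , (λ ()) , refl
∃-⊆-between {X = inside ∷ X} {outside ∷ Z} X⊆Z _ _ = contradiction (X⊆Z here) λ ()
∃-⊆-between {X = inside ∷ X} {inside ∷ Z} X⊆Z (s≤s X≤a) (s≤s a≤Z)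
  with S , X⊆S , S⊆Z , ∣S∣≡a ← ∃-⊆-between (drop-∷-⊆ X⊆Z) X≤a a≤Z
  = inside ∷ S , in⊆in X⊆S , in⊆in S⊆Z , cong suc ∣S∣≡a
∃-⊆-between {X = outside ∷ X} {outside ∷ Z} X⊆Z X≤a a≤Z
  with S , X⊆S , S⊆Z , ∣S∣≡a ← ∃-⊆-between (drop-∷-⊆ X⊆Z) X≤a a≤Z
  = outside ∷ S , out⊆ X⊆S , out⊆ S⊆Z , ∣S∣≡a
∃-⊆-between {X = outside ∷ X} {inside ∷ Z} {a} X⊆Z X≤a a≤1+Z with a ≤? ∣ Z ∣
... | yes a≤Z
  with S , X⊆S , S⊆Z , ∣S∣≡a ← ∃-⊆-between (drop-∷-⊆ X⊆Z) X≤a a≤Z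
  = outside ∷ S , out⊆ X⊆S , out⊆ S⊆Z , ∣S∣≡a
... | no a≰Z with ≰⇒> a≰Z | a≤1+Z
...   | s≤s Z≤a′ | s≤s a′≤Z
  with S , X⊆S , S⊆Z , ∣S∣≡a′ ←
         ∃-⊆-between (drop-∷-⊆ X⊆Z) (≤-trans (p⊆q⇒∣p∣≤∣q∣ (drop-∷-⊆ X⊆Z)) Z≤a′) a′≤Z
  = inside ∷ S , out⊆ X⊆S , in⊆in S⊆Z , cong suc ∣S∣≡a′

∃-⊆-between-comparable : X ⊆ Y → Y ⊆ Z → ∣ X ∣ ≤ a → a ≤ ∣ Z ∣ →
  ∃[ S ] X ⊆ S × S ⊆ Z × ∣ S ∣ ≡ a × (S ⊆ Y ⊎ Y ⊆ S)
∃-⊆-between-comparable {Y = Y} {a = a} X⊆Y Y⊆Z X≤a a≤Z with a ≤? ∣ Y ∣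
... | yes a≤Y
  with S , X⊆S , S⊆Y , ∣S∣≡a ← ∃-⊆-between X⊆Y X≤a a≤Y
  = S , X⊆S , Y⊆Z ∘ S⊆Y , ∣S∣≡a , inj₁ S⊆Y
... | no a≰Y
  with S , Y⊆S , S⊆Z , ∣S∣≡a ← ∃-⊆-between Y⊆Z (≰⇒≥ a≰Y) a≤Z
  = S , Y⊆S ∘ X⊆Y , S⊆Z , ∣S∣≡a , inj₂ Y⊆S

stacksAbove : Position n → ℕ → Subset n
stacksAbove x c = tabulate (λ j → c ≤ᵇ x j)

∈-stacksAbove⁺ : ∀ (x : Position n) c → c ≤ x j → j ∈ stacksAbove x c
∈-stacksAbove⁺ {j = j} x c c≤xj =
  lookup⇒[]= j _ (trans (lookup∘tabulate _ j) (Equivalence.to T-≡ (≤⇒≤ᵇ c≤xj)))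

∈-stacksAbove⁻ : ∀ (x : Position n) c → j ∈ stacksAbove x c → c ≤ x j
∈-stacksAbove⁻ {j = j} x c j∈ =
  ≤ᵇ⇒≤ c (x j) (Equivalence.from T-≡ (trans (sym (lookup∘tabulate _ j)) ([]=⇒lookup j∈)))

above-capacity : ∀ (x : Position n) c → ∣ stacksAbove x c ∣ * c ≤ sum (ctt x c)
above-capacity x c = begin
  ∣ B ∣ * c              ≡⟨ sum-𝟙-* B c ⟨
  sum (λ j → 𝟙 B j * c)  ≤⟨ sum-mono-≤ 𝟙*c≤ ⟩
  sum (ctt x c)          ∎
  where
  open ≤-Reasoning
  B = stacksAbove x c
  𝟙*c≤ : ∀ j → 𝟙 B j * c ≤ x j ⊓ c
  𝟙*c≤ j with j ∈? B
  ... | yes j∈B = ≤-reflexive (trans (*-identityˡ c) (sym (m≥n⇒m⊓n≡n (∈-stacksAbove⁻ x c j∈B))))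
  ... | no  _   = z≤n

capacity-≤-nonempty : ∀ (x : Position n) c → sum (ctt x c) ≤ ∣ stacksAbove x 1 ∣ * c
capacity-≤-nonempty x c = begin
  sum (ctt x c)          ≤⟨ sum-mono-≤ ≤𝟙*c ⟩
  sum (λ j → 𝟙 P j * c)  ≡⟨ sum-𝟙-* P c ⟩
  ∣ P ∣ * c              ∎
  where
  open ≤-Reasoning
  P = stacksAbove x 1
  ≤𝟙*c : ∀ j → x j ⊓ c ≤ 𝟙 P j * c
  ≤𝟙*c j with j ∈? P
  ... | yes _   = ≤-trans (m⊓n≤n (x j) c) (≤-reflexive (sym (*-identityˡ c)))
  ... | no  j∉P = ≤-trans (m⊓n≤m (x j) c) (≮⇒≥ (j∉P ∘ ∈-stacksAbove⁺ x 1))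

¬¬-least : ∀ (P : ℕ → Set) → P k → DoubleNegation (∃[ m ] P m × (∀ m′ → P m′ → m ≤ m′))
¬¬-least {k = k} P Pk = go k (<-wellFounded k) Pk
  where
  go : ∀ k → Acc _<_ k → P k → DoubleNegation (∃[ m ] P m × (∀ m′ → P m′ → m ≤ m′))
  go k (acc smaller) Pk = do
    yes (m , Pm , m<k) ← ¬¬-excluded-middle {A = ∃[ m ] P m × m < k}
      where no none → pure (k , Pk , λ m′ Pm′ → ≮⇒≥ (λ m′<k → none (m′ , Pm′ , m′<k)))
    go m (smaller m<k) Pm

m∸n≡m⇒n≡0 : ∀ {m n} → 1 ≤ m → m ∸ n ≡ m → n ≡ 0
m∸n≡m⇒n≡0 {n = zero}        _ _  = refl
m∸n≡m⇒n≡0 {suc m} {suc n} _ eq = contradiction (≤-trans (≤-reflexive (sym eq)) (m∸n≤m m n)) (n≮n m)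

m⊓n+s≤[m+s]⊓1+n : ∀ m n {s} → s ≤ 1 → m ⊓ n + s ≤ (m + s) ⊓ suc n
m⊓n+s≤[m+s]⊓1+n m n z≤n rewrite +-identityʳ m | +-identityʳ (m ⊓ n) = ⊓-monoʳ-≤ m (n≤1+n n)
m⊓n+s≤[m+s]⊓1+n m n (s≤s z≤n) =
  ≤-reflexive (trans (+-distribʳ-⊓ 1 m n) (cong ((m + 1) ⊓_) (+-comm n 1)))

m⊓1+n≤[m∸1]⊓n+1 : ∀ m n → m ⊓ suc n ≤ (m ∸ 1) ⊓ n + 1
m⊓1+n≤[m∸1]⊓n+1 zero    n = z≤n
m⊓1+n≤[m∸1]⊓n+1 (suc m) n = ≤-reflexive (+-comm 1 (m ⊓ n))

module _ {n : ℕ} {A : ℕ → Set} where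

  private
    variable
      i : Fin n
      x x′ y z t : Position n

  support : Move A x x′ → Subset n
  support (_ , _ , S , _) = S

  move-+𝟙 : (mv : Move A x x′) → ∀ j → x′ j + 𝟙 (support mv) j ≡ x j
  move-+𝟙 (_ , _ , S , _ , nonempty , taken , untouched) j with j ∈? S
  ... | yes j∈S = trans (cong (_+ 1) (taken j j∈S)) (m∸n+n≡m (nonempty j j∈S))
  ... | no  j∉S = trans (+-identityʳ _) (untouched j j∉S)

  move-≤ : Move A x x′ → ∀ j → x′ j ≤ x j
  move-≤ {x′ = x′} mv j = subst (x′ j ≤_) (move-+𝟙 mv j) (m≤m+n _ _)

  reachable-≤ : Reachable A x z → ∀ j → z j ≤ x j
  reachable-≤ ε         j = ≤-refl
  reachable-≤ (mv ◅ mvs) j = ≤-trans (reachable-≤ mvs j) (move-≤ mv j)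

  sum-+-size : (mv : Move A x x′) (f : Position n) →
               sum f + proj₁ mv ≡ sum (λ j → f j + 𝟙 (support mv) j)
  sum-+-size (ℓ , _ , S , ∣S∣≡ℓ , _) f =
    trans (cong (sum f +_) (sym (trans (sum-𝟙 S) ∣S∣≡ℓ))) (sym (∑-distrib-+ f (𝟙 S)))

  sum-move : (mv : Move A x x′) → sum x′ + proj₁ mv ≡ sum x
  sum-move mv = trans (sum-+-size mv _) (sum-cong-≗ (move-+𝟙 mv))

  sum-ctt-move : (mv : Move A x x′) → ∀ c → sum (ctt x′ c) + proj₁ mv ≤ sum (ctt x (suc c))
  sum-ctt-move {x = x} {x′ = x′} mv c = begin
    sum (ctt x′ c) + proj₁ mv                   ≡⟨ sum-+-size mv (ctt x′ c) ⟩
    sum (λ j → x′ j ⊓ c + 𝟙 (support mv) j)     ≤⟨ sum-mono-≤ pointwise ⟩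
    sum (ctt x (suc c))                         ∎
    where
    open ≤-Reasoning
    pointwise : ∀ j → x′ j ⊓ c + 𝟙 (support mv) j ≤ x j ⊓ suc c
    pointwise j = subst (λ v → x′ j ⊓ c + 𝟙 (support mv) j ≤ v ⊓ suc c) (move-+𝟙 mv j)
                        (m⊓n+s≤[m+s]⊓1+n (x′ j) c (𝟙≤1 (support mv) j))

  sum-ctt-mono : (∀ j → x j ≤ y j) → ∀ c → sum (ctt x c) ≤ sum (ctt y c)
  sum-ctt-mono x≤y c = sum-mono-≤ (λ j → ⊓-monoˡ-≤ c (x≤y j))

  Emptiable : Position n → Fin n → Set
  Emptiable x i = ∃[ z ] Reachable A x z × z i ≡ 0

  Fits : Position n → ℕ → Set
  Fits x c = ∃[ a ] A a × a * c ≤ sum (ctt x c)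

  Fits-zero : A a → Fits x 0
  Fits-zero {a = a} Aa = a , Aa , ≤-trans (≤-reflexive (*-zeroʳ a)) z≤n

  Fits-mono : (∀ j → x j ≤ y j) → Fits x c → Fits y c
  Fits-mono x≤y (a , Aa , fits) = a , Aa , ≤-trans fits (sum-ctt-mono x≤y _)

  Fits-suc : Move A x x′ → Fits x′ c → Fits x (suc c)
  Fits-suc {x = x} {x′ = x′} {c = c} mv@(ℓ , Aℓ , _) (a , Aa , fits) = a ⊓ ℓ , A[a⊓ℓ] , (begin
    (a ⊓ ℓ) * suc c      ≡⟨ *-suc (a ⊓ ℓ) c ⟩
    a ⊓ ℓ + (a ⊓ ℓ) * c  ≤⟨ +-mono-≤ (m⊓n≤n a ℓ) (*-monoˡ-≤ c (m⊓n≤m a ℓ)) ⟩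
    ℓ + a * c            ≤⟨ +-monoʳ-≤ ℓ fits ⟩
    ℓ + sum (ctt x′ c)   ≡⟨ +-comm ℓ _ ⟩
    sum (ctt x′ c) + ℓ   ≤⟨ sum-ctt-move mv c ⟩
    sum (ctt x (suc c))  ∎)
    where
    open ≤-Reasoning
    A[a⊓ℓ] : A (a ⊓ ℓ)
    A[a⊓ℓ] = [ (λ eq → subst A (sym eq) Aa) , (λ eq → subst A (sym eq) Aℓ) ]′ (⊓-sel a ℓ)

  Emptiable⇒Fits : Emptiable x i → 1 ≤ c → c ≤ x i → Fits x c
  Emptiable⇒Fits {i = i} (z , mvs , zi≡0) = go mvs
    where
    go : Reachable A y z → 1 ≤ c → c ≤ y i → Fits y c
    go ε 1≤c c≤yi = contradiction (≤-trans 1≤c (≤-trans c≤yi (≤-reflexive zi≡0))) λ ()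
    go (mv@(ℓ , Aℓ , S , _ , _ , taken , untouched) ◅ mvs) 1≤c c≤yi with i ∈? S
    ... | no i∉S =
            Fits-mono (move-≤ mv) (go mvs 1≤c (≤-trans c≤yi (≤-reflexive (sym (untouched i i∉S)))))
    ... | yes i∈S with 1≤c
    ...   | s≤s {n = zero}  _ = Fits-suc mv (Fits-zero Aℓ)
    ...   | s≤s {n = suc _} _ =
            Fits-suc mv (go mvs (s≤s z≤n) (≤-trans (∸-monoˡ-≤ 1 c≤yi) (≤-reflexive (sym (taken i i∈S)))))

  remove : Subset n → Position n → Position n
  remove S y j = y j ∸ 𝟙 S j

  remove-Move : A ∣ S ∣ → S ⊆ stacksAbove y 1 → Move A y (remove S y)
  remove-Move {S = S} {y = y} A∣S∣ S⊆P = ∣ S ∣ , A∣S∣ , S , refl , nonempty , taken , untouched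
    where
    nonempty : ∀ j → j ∈ S → 1 ≤ y j
    nonempty j j∈S = ∈-stacksAbove⁻ y 1 (S⊆P j∈S)
    taken : ∀ j → j ∈ S → remove S y j ≡ y j ∸ 1
    taken j j∈S = cong (y j ∸_) (𝟙-∈ j∈S)
    untouched : ∀ j → j ∉ S → remove S y j ≡ y j
    untouched j j∉S = cong (y j ∸_) (𝟙-∉ j∉S)

  sum-ctt-remove : S ⊆ U → stacksAbove y (suc c) ⊆ U →
                   sum (ctt y (suc c)) ≤ sum (ctt (remove S y) c) + ∣ U ∣
  sum-ctt-remove {S = S} {U = U} {y = y} {c = c} S⊆U B⊆U = begin
    sum (ctt y (suc c))                           ≤⟨ sum-mono-≤ pointwise ⟩
    sum (λ j → remove S y j ⊓ c + 𝟙 U j)          ≡⟨ ∑-distrib-+ (ctt (remove S y) c) (𝟙 U) ⟩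
    sum (ctt (remove S y) c) + sum (𝟙 U)          ≡⟨ cong (sum (ctt (remove S y) c) +_) (sum-𝟙 U) ⟩
    sum (ctt (remove S y) c) + ∣ U ∣              ∎
    where
    open ≤-Reasoning
    pointwise : ∀ j → y j ⊓ suc c ≤ remove S y j ⊓ c + 𝟙 U j
    pointwise j with j ∈? U
    ... | yes _ = ≤-trans (m⊓1+n≤[m∸1]⊓n+1 (y j) c)
                          (+-monoˡ-≤ 1 (⊓-monoˡ-≤ c (∸-monoʳ-≤ (y j) (𝟙≤1 S j))))
    ... | no j∉U rewrite 𝟙-∉ (j∉U ∘ S⊆U) | +-identityʳ (y j ⊓ c)
                       | m≤n⇒m⊓n≡m (≮⇒≥ (j∉U ∘ B⊆U ∘ ∈-stacksAbove⁺ y (suc c)))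
                       = m⊓n≤m (y j) (suc c)

  Fits-remove : S ⊆ U → stacksAbove y (suc c) ⊆ U →
                a ≤ ∣ U ∣ → ∣ U ∣ * suc c ≤ sum (ctt y (suc c)) →
                a * c ≤ sum (ctt (remove S y) c)
  Fits-remove {S = S} {U = U} {y = y} {c = c} {a = a} S⊆U B⊆U a≤u u*[1+c]≤ = begin
    a * c                     ≤⟨ *-monoˡ-≤ c a≤u ⟩
    ∣ U ∣ * c                  ≤⟨ +-cancelʳ-≤ ∣ U ∣ _ _ u*c+u≤ ⟩
    sum (ctt (remove S y) c)  ∎
    where
    open ≤-Reasoning
    u*c+u≤ : ∣ U ∣ * c + ∣ U ∣ ≤ sum (ctt (remove S y) c) + ∣ U ∣
    u*c+u≤ = begin
      ∣ U ∣ * c + ∣ U ∣                   ≡⟨ +-comm _ ∣ U ∣ ⟩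
      ∣ U ∣ + ∣ U ∣ * c                   ≡⟨ *-suc ∣ U ∣ c ⟨
      ∣ U ∣ * suc c                      ≤⟨ u*[1+c]≤ ⟩
      sum (ctt y (suc c))               ≤⟨ sum-ctt-remove S⊆U B⊆U ⟩
      sum (ctt (remove S y) c) + ∣ U ∣   ∎

  Fits-ctt : c ≤ m → Fits x c → Fits (ctt x m) c
  Fits-ctt {c = c} {m = m} {x = x} c≤m (a , Aa , fits) = a , Aa , subst (a * c ≤_) (sum-cong-≗ ctt-ctt) fits
    where
    ctt-ctt : ∀ j → ctt x c j ≡ ctt (ctt x m) c j
    ctt-ctt j = sym (trans (⊓-assoc (x j) m c) (cong (x j ⊓_) (m≥n⇒m⊓n≡n c≤m)))

  Reduced⇒u≡0 : Reduced A x → 1 ≤ x i → IsU A x i k → k ≡ 0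
  Reduced⇒u≡0 {i = i} {k = k} reduced 1≤xi u = m∸n≡m⇒n≡0 1≤xi (reduced i k u)

  u≡0⇒Reduced : (∀ {i k} → 1 ≤ x i → IsU A x i k → k ≡ 0) → Reduced A x
  u≡0⇒Reduced {x = x} u≡0 i k u with x i in xi≡
  ... | zero  = 0∸n≡0 k
  ... | suc _ rewrite u≡0 (≤-trans (s≤s z≤n) (≤-reflexive (sym xi≡))) u = refl

  module _ (positive : ∀ {ℓ} → A ℓ → 1 ≤ ℓ) where

    emptying-move : y i ≡ suc c → A a → a * suc c ≤ sum (ctt y (suc c)) →
                    ∃[ y′ ] Move A y y′ × y′ i ≡ c × a * c ≤ sum (ctt y′ c)
    emptying-move {y = y} {i = i} {c = c} {a = a} yi≡1+c Aa fits =
      choose (∃-⊆-between-comparable ⁅i⁆⊆B B⊆P ∣⁅i⁆∣≤a a≤∣P∣)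
      where
      B P : Subset n
      B = stacksAbove y (suc c)
      P = stacksAbove y 1
      ⁅i⁆⊆B : ⁅ i ⁆ ⊆ B
      ⁅i⁆⊆B j∈⁅i⁆ rewrite x∈⁅y⁆⇒x≡y i j∈⁅i⁆ = ∈-stacksAbove⁺ y (suc c) (≤-reflexive (sym yi≡1+c))
      B⊆P : B ⊆ P
      B⊆P j∈B = ∈-stacksAbove⁺ y 1 (≤-trans (s≤s z≤n) (∈-stacksAbove⁻ y (suc c) j∈B))
      ∣⁅i⁆∣≤a : ∣ ⁅ i ⁆ ∣ ≤ a
      ∣⁅i⁆∣≤a = subst (_≤ a) (sym (∣⁅x⁆∣≡1 i)) (positive Aa)
      a≤∣P∣ : a ≤ ∣ P ∣
      a≤∣P∣ = *-cancelʳ-≤ a ∣ P ∣ (suc c) (≤-trans fits (capacity-≤-nonempty y (suc c)))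
      choose : ∃[ S ] ⁅ i ⁆ ⊆ S × S ⊆ P × ∣ S ∣ ≡ a × (S ⊆ B ⊎ B ⊆ S) →
               ∃[ y′ ] Move A y y′ × y′ i ≡ c × a * c ≤ sum (ctt y′ c)
      choose (S , ⁅i⁆⊆S , S⊆P , ∣S∣≡a , comparable) =
        remove S y , remove-Move (subst A (sym ∣S∣≡a) Aa) S⊆P , y′i≡c , fits′ comparable
        where
        y′i≡c : remove S y i ≡ c
        y′i≡c = cong₂ _∸_ yi≡1+c (𝟙-∈ (⁅i⁆⊆S (x∈⁅x⁆ i)))
        fits′ : S ⊆ B ⊎ B ⊆ S → a * c ≤ sum (ctt (remove S y) c)
        fits′ (inj₁ S⊆B) = Fits-remove S⊆B (λ j∈B → j∈B)
          (subst (_≤ ∣ B ∣) ∣S∣≡a (p⊆q⇒∣p∣≤∣q∣ S⊆B)) (above-capacity y (suc c))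
        fits′ (inj₂ B⊆S) = Fits-remove (λ j∈S → j∈S) B⊆S
          (≤-reflexive (sym ∣S∣≡a)) (subst (λ s → s * suc c ≤ _) (sym ∣S∣≡a) fits)

    Fits⇒Emptiable : y i ≡ c → Fits y c → Emptiable y i
    Fits⇒Emptiable {y = y} {c = zero}  yi≡0   _ = y , ε , yi≡0
    Fits⇒Emptiable {c = suc c} yi≡1+c (a , Aa , fits)
      with y′ , mv , y′i≡c , fits′ ← emptying-move yi≡1+c Aa fits
      with z , mvs , zi≡0 ← Fits⇒Emptiable y′i≡c (a , Aa , fits′)
      = z , mv ◅ mvs , zi≡0

    sum-move-< : Move A x x′ → sum x′ < sum x
    sum-move-< {x′ = x′} mv@(_ , Aℓ , _) =
      <-≤-trans (m<m+n (sum x′) (positive Aℓ)) (≤-reflexive (sum-move mv))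

    terminal-reachable : ∀ x → DoubleNegation (∃[ t ] InT A x t)
    terminal-reachable x = go x (<-wellFounded (sum x))
      where
      go : ∀ x → Acc _<_ (sum x) → DoubleNegation (∃[ t ] InT A x t)
      go x (acc smaller) = do
        yes (x′ , mv) ← ¬¬-excluded-middle {A = ∃ (Move A x)}
          where no stuck → pure (x , ε , λ x′ mv → stuck (x′ , mv))
        t , mvs , terminal ← go x′ (smaller (sum-move-< mv))
        pure (t , mv ◅ mvs , terminal)

    ¬¬-IsU : InT A x t → DoubleNegation (∃ (IsU A x i))
    ¬¬-IsU {x = x} {t = t} {i = i} t∈𝒯 = do
      k , (t , t∈𝒯 , ti≡k) , least ← ¬¬-least (λ k → ∃[ t ] InT A x t × t i ≡ k) (t , t∈𝒯 , refl)
      pure (k , (t , t∈𝒯 , ti≡k) , λ t′ t′∈𝒯 → least (t′ i) (t′ , t′∈𝒯 , refl))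

    Emptiable-ctt : Emptiable x i → 1 ≤ ctt x m i → Emptiable (ctt x m) i
    Emptiable-ctt {x = x} {i = i} {m = m} emptiable 1≤c =
      Fits⇒Emptiable refl (Fits-ctt (m⊓n≤n (x i) m) (Emptiable⇒Fits emptiable 1≤c (m⊓n≤m (x i) m)))

    Reduced⇒¬¬Emptiable : Reduced A x → 1 ≤ x i → DoubleNegation (Emptiable x i)
    Reduced⇒¬¬Emptiable {x = x} reduced 1≤xi = do
      _ , t∈𝒯 ← terminal-reachable x
      _ , u@((t , (mvs , _) , ti≡k) , _) ← ¬¬-IsU t∈𝒯
      pure (t , mvs , trans ti≡k (Reduced⇒u≡0 reduced 1≤xi u))

    ¬¬Emptiable⇒u≡0 : DoubleNegation (Emptiable x i) → IsU A x i k → k ≡ 0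
    ¬¬Emptiable⇒u≡0 {i = i} {k = k} emptiable (_ , least) = decidable-stable (k ≟ 0) do
      z , mvs , zi≡0 ← emptiable
      t , mvs′ , terminal ← terminal-reachable z
      pure (n≤0⇒n≡0 (≤-trans (least t (mvs ◅◅ mvs′ , terminal))
                             (≤-trans (reachable-≤ mvs′ i) (≤-reflexive zi≡0))))

lemma2 : (n : ℕ) → 1 ≤ n → (A : ℕ → Set)
    → (∀ ℓ → A ℓ → 1 ≤ ℓ × ℓ ≤ n) → (∃ λ ℓ → A ℓ)
    → (p : Position n) → Reduced A p
    → (m : ℕ) → Reduced A (ctt p m)
lemma2 _ _ A bounds _ p reduced m = u≡0⇒Reduced λ 1≤qi →
  ¬¬Emptiable⇒u≡0 positive
    (¬¬-map (λ emptiable → Emptiable-ctt positive emptiable 1≤qi)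
            (Reduced⇒¬¬Emptiable positive reduced (≤-trans 1≤qi (m⊓n≤m _ m))))
  where
  positive : ∀ {ℓ} → A ℓ → 1 ≤ ℓ
  positive Aℓ = proj₁ (bounds _ Aℓ)
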